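{- Let $w\in S_n$ be vexillary. Suppose $(i_1,j_1),(i_2,j_2)\in D(w)$ are linked and $i_1<i_2$. Then $(i,j_1)\in D(w)$ for all $i_1\le i\le i_2$.
   Context: $w$ is vexillary if it avoids the pattern $2143$. Rothe diagram: $D(w)=\{(i,j)\in[n]\times[n]:i<w^{ -1}(j),\ j<w(i)\}$ ($i$ = row, $j$ = column), with rank function $r(i,j)=|\{k<i:w(k)<j\}|$. Two squares $(i,j),(i',j')\in D(w)$ are linked if $i-i'=r(i,j)-r(i',j')$. -}

module Defs where

open import Data.Nat using (ℕ; _<_; _≤_)
open import Data.Nat.Properties using (_<?_)
open import Data.Fin using (Fin; toℕ)
open import Data.Fin.Properties renaming (_<?_ to _<ᶠ?_)
open import Data.Integer using (ℤ; _-_; +_)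
open import Data.List using (length; filter; allFin)
open import Data.Product using (_×_; ∃-syntax)
open import Relation.Nullary using (¬_)
open import Relation.Nullary.Decidable using (_×-dec_)
open import Data.Fin.Permutation using (Permutation′; _⟨$⟩ʳ_; _⟨$⟩ˡ_)

-- A permutation w ∈ S_n, acting on Fin n = {0,…,n-1} (0-based positions;
-- all notions below depend only on relative order, so this is harmless).
Perm : ℕ → Set
Perm n = Permutation′ n

app : ∀ {n} → Perm n → Fin n → Fin n
app w i = w ⟨$⟩ʳ i

inv : ∀ {n} → Perm n → Fin n → Fin n
inv w j = w ⟨$⟩ˡ j

Contains2143 : ∀ {n} → Perm n → Set
Contains2143 {n} w = ∃[ a ] ∃[ b ] ∃[ c ] ∃[ d ]
  ((a Data.Fin.< b) × (b Data.Fin.< c) × (c Data.Fin.< d) ×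
   (app w b Data.Fin.< app w a) × (app w a Data.Fin.< app w d) × (app w d Data.Fin.< app w c))

Vexillary : ∀ {n} → Perm n → Set
Vexillary w = ¬ Contains2143 w

InD : ∀ {n} → Perm n → Fin n → Fin n → Set
InD w i j = (i Data.Fin.< inv w j) × (j Data.Fin.< app w i)

rank : ∀ {n} → Perm n → Fin n → Fin n → ℕ
rank {n} w i j =
  length (filter (λ k → (k <ᶠ? i) ×-dec (app w k <ᶠ? j)) (allFin n))

-- squares (i,j), (i',j') (membership in D(w) assumed separately) are linked if i - i' = r(i,j) - r(i',j')  (in ℤ)
Linked : ∀ {n} → Perm n → Fin n → Fin n → Fin n → Fin n → Set
Linked w i j i' j' =
  (+ toℕ i) - (+ toℕ i') ≡ℤ (+ rank w i j) - (+ rank w i' j')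
  where open import Relation.Binary.PropositionalEquality using () renaming (_≡_ to _≡ℤ_)

{-# OPTIONS --safe #-}
module Submission where

-- Counting dots of w's permutation matrix: r(i₂,j₂) is at most r(i₁,j₁), plus the
-- dots in the rows strictly between i₁ and i₂, plus the dots in rows ≤ i₁ and columns
-- [j₁, j₂).  Linkedness says r(i₂,j₂) − r(i₁,j₁) = i₂ − i₁, one more than the number of
-- intermediate rows, so some dot p ≤ i₁ has j₁ ≤ w(p) < j₂.  If an intermediate row k
-- had w(k) ≤ j₁, then p, k, i₂, w⁻¹(j₂) would form a 2143; hence every row of [i₁, i₂]
-- has its dot strictly right of column j₁; in particular w⁻¹(j₁) > i₂.

open import Level using (Level; 0ℓ)
open import Data.Nat as ℕ using (ℕ; zero; suc; z≤n; s≤s; s≤s⁻¹; _+_)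
import Data.Nat.Properties as ℕ
open import Data.Nat.Tactic.RingSolver using (solve-∀)
open import Data.Fin using (Fin; toℕ; _<_; _≤_)
open import Data.Fin.Properties using (toℕ<n; _<?_; _≤?_; <-cmp; <-irrefl; <⇒≢; ≤∧≢⇒<)
import Data.Integer as ℤ
import Data.Integer.Properties as ℤ
open import Data.Integer.Tactic.RingSolver renaming (solve-∀ to solve-∀ℤ)
open import Data.List using (List; []; _∷_; filter; length; map; tabulate; allFin)
open import Data.List.Properties using (filter-≐; filter-none; map-tabulate)
open import Data.List.Relation.Unary.All using (universal)
open import Data.Product using (∃; _×_; _,_; proj₂)
open import Data.Sum using (inj₁; inj₂)
open import Data.Empty using (⊥; ⊥-elim)
open import Relation.Nullary using (yes; no; contradiction)
open import Relation.Nullary.Decidable using (_×-dec_)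
open import Relation.Unary using (Pred; Decidable; _⊆_; _∪_; _∩_; ∅)
open import Relation.Unary.Properties using (_∪?_)
open import Relation.Binary.Definitions using (tri<; tri≈; tri>)
open import Function using (id)
open import Relation.Binary.PropositionalEquality
open import Data.Fin.Permutation using (inverseˡ; inverseʳ)
open import Defs

private variable
  a b p q r : Level
  A : Set a
  B : Set b

count : {P : Pred A p} → Decidable P → List A → ℕ
count P? xs = length (filter P? xs)

count-map : {P : Pred A p} (P? : Decidable P) (f : B → A) (xs : List B) →
            count P? (map f xs) ≡ count (λ x → P? (f x)) xs
count-map P? f []       = refl
count-map P? f (x ∷ xs) with P? (f x)
... | yes _ = cong suc (count-map P? f xs)
... | no  _ = count-map P? f xs

count>0⇒∃ : {P : Pred A p} (P? : Decidable P) (xs : List A) → 0 ℕ.< count P? xs → ∃ P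
count>0⇒∃ P? (x ∷ xs) pos with P? x
... | yes px = x , px
... | no  _  = count>0⇒∃ P? xs pos

count-mono-∪ : {P : Pred A p} {Q : Pred A q} {R : Pred A r}
               (P? : Decidable P) (Q? : Decidable Q) (R? : Decidable R) →
               P ⊆ Q ∪ R → ∀ xs → count P? xs ℕ.≤ count Q? xs + count R? xs
count-mono-∪ P? Q? R? P⊆Q∪R []       = z≤n
count-mono-∪ P? Q? R? P⊆Q∪R (x ∷ xs)
  with ih ← count-mono-∪ P? Q? R? P⊆Q∪R xs | P? x | Q? x | R? x
... | yes _  | yes _ | yes _ = s≤s (ℕ.≤-trans ih (ℕ.+-monoʳ-≤ _ (ℕ.n≤1+n _)))
... | yes _  | yes _ | no  _ = s≤s ih
... | yes _  | no  _ | yes _ = ℕ.≤-trans (s≤s ih) (ℕ.≤-reflexive (sym (ℕ.+-suc _ _)))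
... | yes px | no ¬q | no ¬r = contradiction (P⊆Q∪R px) λ { (inj₁ q) → ¬q q ; (inj₂ r) → ¬r r }
... | no  _  | yes _ | yes _ = ℕ.≤-trans ih (ℕ.+-mono-≤ (ℕ.n≤1+n _) (ℕ.n≤1+n _))
... | no  _  | yes _ | no  _ = ℕ.m≤n⇒m≤1+n ih
... | no  _  | no  _ | yes _ = ℕ.≤-trans ih (ℕ.+-monoʳ-≤ _ (ℕ.n≤1+n _))
... | no  _  | no  _ | no  _ = ih

count-disjoint-+-≤ : {P : Pred A p} {Q : Pred A q} {R : Pred A r}
                     (P? : Decidable P) (Q? : Decidable Q) (R? : Decidable R) →
                     Q ⊆ P → R ⊆ P → Q ∩ R ⊆ ∅ → ∀ xs → count Q? xs + count R? xs ℕ.≤ count P? xs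
count-disjoint-+-≤ P? Q? R? Q⊆P R⊆P Q∩R⊆∅ []       = z≤n
count-disjoint-+-≤ P? Q? R? Q⊆P R⊆P Q∩R⊆∅ (x ∷ xs)
  with ih ← count-disjoint-+-≤ P? Q? R? Q⊆P R⊆P Q∩R⊆∅ xs | P? x | Q? x | R? x
... | _      | yes qx | yes rx = ⊥-elim (Q∩R⊆∅ (qx , rx))
... | yes _  | yes _  | no  _  = s≤s ih
... | yes _  | no  _  | yes _  = ℕ.≤-trans (ℕ.≤-reflexive (ℕ.+-suc _ _)) (s≤s ih)
... | yes _  | no  _  | no  _  = ℕ.m≤n⇒m≤1+n ih
... | no ¬px | yes qx | no  _  = contradiction (Q⊆P qx) ¬px
... | no ¬px | no  _  | yes rx = contradiction (R⊆P rx) ¬px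
... | no  _  | no  _  | no  _  = ih

count-toℕ< : ∀ n m → m ℕ.≤ n → count (λ (k : Fin n) → toℕ k ℕ.<? m) (allFin n) ≡ m
count-toℕ< n       zero    _         =
  cong length (filter-none (λ k → toℕ k ℕ.<? 0) (universal (λ _ ()) (allFin n)))
count-toℕ< (suc n) (suc m) (s≤s m≤n) = cong suc (begin
  count (λ k → toℕ k ℕ.<? suc m) (tabulate (Fin.suc {n}))
    ≡⟨ cong (count (λ k → toℕ k ℕ.<? suc m)) (sym (map-tabulate {n = n} id Fin.suc)) ⟩
  count (λ k → toℕ k ℕ.<? suc m) (map Fin.suc (allFin n))
    ≡⟨ count-map _ Fin.suc (allFin n) ⟩
  count (λ k → suc (toℕ k) ℕ.<? suc m) (allFin n)
    ≡⟨ cong length (filter-≐ _ _ (s≤s⁻¹ , s≤s) (allFin n)) ⟩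
  count (λ k → toℕ k ℕ.<? m) (allFin n)
    ≡⟨ count-toℕ< n m m≤n ⟩
  m ∎)
  where open ≡-Reasoning

count-open-interval : ∀ n l u → l ℕ.< u → u ℕ.≤ n →
  count (λ (k : Fin n) → (l ℕ.<? toℕ k) ×-dec (toℕ k ℕ.<? u)) (allFin n) + suc l ℕ.≤ u
count-open-interval n l u l<u u≤n = begin
  inside + suc l
    ≡⟨ cong (inside +_) (count-toℕ< n (suc l) (ℕ.≤-trans l<u u≤n)) ⟨
  inside + count (below (suc l)) (allFin n)
    ≤⟨ count-disjoint-+-≤ (below u) _ _ proj₂ below-l⊆below-u disjoint (allFin n) ⟩
  count (below u) (allFin n)
    ≡⟨ count-toℕ< n u u≤n ⟩
  u ∎
  where
  open ℕ.≤-Reasoning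
  below : ∀ m → Decidable (λ (k : Fin n) → toℕ k ℕ.< m)
  below m k = toℕ k ℕ.<? m
  inside : ℕ
  inside = count (λ k → (l ℕ.<? toℕ k) ×-dec (toℕ k ℕ.<? u)) (allFin n)
  below-l⊆below-u : (λ (k : Fin n) → toℕ k ℕ.< suc l) ⊆ (λ k → toℕ k ℕ.< u)
  below-l⊆below-u k≤l = ℕ.≤-<-trans (s≤s⁻¹ k≤l) l<u
  disjoint : (λ (k : Fin n) → l ℕ.< toℕ k × toℕ k ℕ.< u) ∩ (λ k → toℕ k ℕ.< suc l) ⊆ ∅
  disjoint ((l<k , _) , k≤l) = ℕ.<-irrefl refl (ℕ.<-≤-trans l<k (s≤s⁻¹ k≤l))

m-n≡o-p⇒m+p≡o+n : ∀ m n o p → ℤ.+ m ℤ.- ℤ.+ n ≡ ℤ.+ o ℤ.- ℤ.+ p → m + p ≡ o + n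
m-n≡o-p⇒m+p≡o+n m n o p eq = ℤ.+-injective (begin
  ℤ.+ (m + p)                             ≡⟨ ℤ.pos-+ m p ⟩
  ℤ.+ m ℤ.+ ℤ.+ p                         ≡⟨ split (ℤ.+ m) (ℤ.+ n) (ℤ.+ p) ⟩
  (ℤ.+ m ℤ.- ℤ.+ n) ℤ.+ (ℤ.+ n ℤ.+ ℤ.+ p) ≡⟨ cong (ℤ._+ (ℤ.+ n ℤ.+ ℤ.+ p)) eq ⟩
  (ℤ.+ o ℤ.- ℤ.+ p) ℤ.+ (ℤ.+ n ℤ.+ ℤ.+ p) ≡⟨ merge (ℤ.+ o) (ℤ.+ n) (ℤ.+ p) ⟩
  ℤ.+ o ℤ.+ ℤ.+ n                         ≡⟨ ℤ.pos-+ o n ⟨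
  ℤ.+ (o + n)                             ∎)
  where
  open ≡-Reasoning
  split : ∀ x y z → x ℤ.+ z ≡ (x ℤ.- y) ℤ.+ (y ℤ.+ z)
  split = solve-∀ℤ
  merge : ∀ x y z → (x ℤ.- z) ℤ.+ (y ℤ.+ z) ≡ x ℤ.+ y
  merge = solve-∀ℤ

module _ {n : ℕ} (w : Perm n) where

  app-injective : ∀ {a b} → app w a ≡ app w b → a ≡ b
  app-injective {a} {b} eq = begin
    a               ≡⟨ inverseˡ w ⟨
    inv w (app w a) ≡⟨ cong (inv w) eq ⟩
    inv w (app w b) ≡⟨ inverseˡ w ⟩
    b               ∎
    where open ≡-Reasoning

  vexillary⇒no-21-northwest-of-D : Vexillary w → ∀ {a b c j : Fin n} → InD w c j →
    a < b → b < c → app w b < app w a → app w a < j → ⊥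
  vexillary⇒no-21-northwest-of-D vex {j = j} (c<d , j<wc) a<b b<c wb<wa wa<j =
    vex (_ , _ , _ , inv w j , a<b , b<c , c<d , wb<wa ,
         subst (app w _ <_) (sym (inverseʳ w)) wa<j , subst (_< app w _) (sym (inverseʳ w)) j<wc)

  -- rank w i j is, by definition, count (NorthWest? i j) (allFin n).
  NorthWest? : ∀ (i j : Fin n) → Decidable (λ (k : Fin n) → k < i × app w k < j)
  NorthWest? i j k = (k <? i) ×-dec (app w k <? j)

  SeparatingDot : Fin n → Fin n → Fin n → Pred (Fin n) 0ℓ
  SeparatingDot i j j′ p = p ≤ i × j ≤ app w p × app w p < j′

  SeparatingDot? : ∀ (i j j′ : Fin n) → Decidable (SeparatingDot i j j′)
  SeparatingDot? i j j′ p = (p ≤? i) ×-dec (j ≤? app w p) ×-dec (app w p <? j′)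

  rank-gap : ∀ {i₁ j₁ i₂ j₂ : Fin n} → j₁ ≤ app w i₁ → i₁ < i₂ →
    rank w i₂ j₂ + suc (toℕ i₁) ℕ.≤ rank w i₁ j₁ + toℕ i₂ + count (SeparatingDot? i₁ j₁ j₂) (allFin n)
  rank-gap {i₁} {j₁} {i₂} {j₂} j₁≤wi₁ i₁<i₂ = begin
    rank w i₂ j₂ + suc (toℕ i₁)
      ≤⟨ ℕ.+-monoˡ-≤ _ rank-bound ⟩
    rank w i₁ j₁ + (inside + separating) + suc (toℕ i₁)
      ≡⟨ regroup (rank w i₁ j₁) inside separating (suc (toℕ i₁)) ⟩
    rank w i₁ j₁ + (inside + suc (toℕ i₁)) + separating
      ≤⟨ ℕ.+-monoˡ-≤ separating (ℕ.+-monoʳ-≤ (rank w i₁ j₁) interval-bound) ⟩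
    rank w i₁ j₁ + toℕ i₂ + separating ∎
    where
    open ℕ.≤-Reasoning
    Inside? : Decidable (λ (k : Fin n) → i₁ < k × k < i₂)
    Inside? k = (toℕ i₁ ℕ.<? toℕ k) ×-dec (toℕ k ℕ.<? toℕ i₂)
    inside separating : ℕ
    inside     = count Inside? (allFin n)
    Separating? = SeparatingDot? i₁ j₁ j₂
    separating = count Separating? (allFin n)
    cover : (λ k → k < i₂ × app w k < j₂) ⊆
            (λ k → k < i₁ × app w k < j₁) ∪ ((λ k → i₁ < k × k < i₂) ∪ SeparatingDot i₁ j₁ j₂)
    cover {k} (k<i₂ , wk<j₂) with <-cmp k i₁ | app w k <? j₁
    ... | tri< k<i₁ _ _ | yes wk<j₁ = inj₁ (k<i₁ , wk<j₁)
    ... | tri< k<i₁ _ _ | no  wk≮j₁ = inj₂ (inj₂ (ℕ.<⇒≤ k<i₁ , ℕ.≮⇒≥ wk≮j₁ , wk<j₂))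
    ... | tri≈ _ refl _ | _         = inj₂ (inj₂ (ℕ.≤-refl , j₁≤wi₁ , wk<j₂))
    ... | tri> _ _ i₁<k | _         = inj₂ (inj₁ (i₁<k , k<i₂))
    rank-bound : rank w i₂ j₂ ℕ.≤ rank w i₁ j₁ + (inside + separating)
    rank-bound = ℕ.≤-trans
      (count-mono-∪ (NorthWest? i₂ j₂) (NorthWest? i₁ j₁) (Inside? ∪? Separating?) cover (allFin n))
      (ℕ.+-monoʳ-≤ _ (count-mono-∪ (Inside? ∪? Separating?) Inside? Separating? id (allFin n)))
    interval-bound : inside + suc (toℕ i₁) ℕ.≤ toℕ i₂
    interval-bound = count-open-interval n (toℕ i₁) (toℕ i₂) i₁<i₂ (ℕ.<⇒≤ (toℕ<n i₂))
    regroup : ∀ r c s t → r + (c + s) + t ≡ r + (c + t) + s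
    regroup = solve-∀

  linked⇒separating-dot : ∀ {i₁ j₁ i₂ j₂ : Fin n} → InD w i₁ j₁ → Linked w i₁ j₁ i₂ j₂ → i₁ < i₂ →
    ∃ (SeparatingDot i₁ j₁ j₂)
  linked⇒separating-dot {i₁} {j₁} {i₂} {j₂} (_ , j₁<wi₁) linked i₁<i₂ =
    count>0⇒∃ (SeparatingDot? i₁ j₁ j₂) (allFin n) (ℕ.+-cancelˡ-≤ (rank w i₁ j₁ + toℕ i₂) 1 _ (begin
      rank w i₁ j₁ + toℕ i₂ + 1    ≡⟨ ℕ.+-comm _ 1 ⟩
      suc (rank w i₁ j₁ + toℕ i₂)  ≡⟨ cong suc linked′ ⟨
      suc (toℕ i₁ + rank w i₂ j₂)  ≡⟨ cong suc (ℕ.+-comm (toℕ i₁) _) ⟩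
      suc (rank w i₂ j₂ + toℕ i₁)  ≡⟨ ℕ.+-suc _ _ ⟨
      rank w i₂ j₂ + suc (toℕ i₁)  ≤⟨ rank-gap (ℕ.<⇒≤ j₁<wi₁) i₁<i₂ ⟩
      rank w i₁ j₁ + toℕ i₂ + count (SeparatingDot? i₁ j₁ j₂) (allFin n) ∎))
    where
    open ℕ.≤-Reasoning
    linked′ : toℕ i₁ + rank w i₂ j₂ ≡ rank w i₁ j₁ + toℕ i₂
    linked′ = m-n≡o-p⇒m+p≡o+n (toℕ i₁) (toℕ i₂) (rank w i₁ j₁) (rank w i₂ j₂) linked

  vexillary⇒right-of-column : Vexillary w → ∀ {i₁ j₁ i₂ j₂ p : Fin n} →
    InD w i₁ j₁ → InD w i₂ j₂ → SeparatingDot i₁ j₁ j₂ p → ∀ {k} → i₁ ≤ k → k ≤ i₂ → j₁ < app w k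
  vexillary⇒right-of-column vex {i₁} {j₁} {i₂} {p = p}
    (_ , j₁<wi₁) d₂@(_ , j₂<wi₂) (p≤i₁ , j₁≤wp , wp<j₂) {k} i₁≤k k≤i₂ with j₁ <? app w k
  ... | yes j₁<wk = j₁<wk
  ... | no  j₁≮wk = ⊥-elim (vexillary⇒no-21-northwest-of-D vex d₂ p<k k<i₂ wk<wp wp<j₂)
    where
    i₁<k : i₁ < k
    i₁<k = ≤∧≢⇒< i₁≤k λ { refl → j₁≮wk j₁<wi₁ }
    k<i₂ : k < i₂
    k<i₂ = ≤∧≢⇒< k≤i₂ λ { refl → j₁≮wk (ℕ.≤-<-trans j₁≤wp (ℕ.<-trans wp<j₂ j₂<wi₂)) }
    p<k : p < k
    p<k = ℕ.≤-<-trans p≤i₁ i₁<k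
    wk<wp : app w k < app w p
    wk<wp = ≤∧≢⇒< (ℕ.≤-trans (ℕ.≮⇒≥ j₁≮wk) j₁≤wp) (λ e → <⇒≢ p<k (sym (app-injective e)))

  column-in-D : ∀ {i₁ j₁ i₂ i : Fin n} → InD w i₁ j₁ → (∀ {k} → i₁ ≤ k → k ≤ i₂ → j₁ < app w k) →
    i₁ ≤ i → i ≤ i₂ → InD w i j₁
  column-in-D {j₁ = j₁} {i = i} (i₁<w⁻¹j₁ , _) right i₁≤i i≤i₂ with i <? inv w j₁
  ... | yes i<w⁻¹j₁ = i<w⁻¹j₁ , right i₁≤i i≤i₂
  ... | no  i≮w⁻¹j₁ = ⊥-elim (<-irrefl (sym (inverseʳ w))
                          (right (ℕ.<⇒≤ i₁<w⁻¹j₁) (ℕ.≤-trans (ℕ.≮⇒≥ i≮w⁻¹j₁) i≤i₂)))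

lemma4p4 : (n : ℕ) (w : Perm n) → Vexillary w →
    (i₁ j₁ i₂ j₂ : Fin n) →
    InD w i₁ j₁ → InD w i₂ j₂ → Linked w i₁ j₁ i₂ j₂ → i₁ < i₂ →
    (i : Fin n) → i₁ ≤ i → i ≤ i₂ → InD w i j₁
lemma4p4 n w vex i₁ j₁ i₂ j₂ d₁ d₂ linked i₁<i₂ i i₁≤i i≤i₂ =
  let (_ , separating) = linked⇒separating-dot w d₁ linked i₁<i₂
  in column-in-D w d₁ (vexillary⇒right-of-column w vex d₁ d₂ separating) i₁≤i i≤i₂
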